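{- If $\mathsf{IKt}2\vdash A$ then $\mathfrak{B}\models A$ for every birelational model $\mathfrak{B}$.
   Context: Formulas: $A ::= P \mid X \mid A\to B \mid \Box A \mid \blacksquare A \mid \forall X A$, with $\bot := \forall XX$, $\neg A := A\to\bot$, $\Diamond A := \forall X(\Box(A\to\blacksquare X)\to X)$, backward diamond $\Diamond^{\bullet} A := \forall X(\blacksquare(A\to\Box X)\to X)$. $\mathsf{IKt}2$: second-order intuitionistic propositional logic (with full comprehension $\forall XA\to A[C/X]$, modus ponens, generalisation with fresh propositional symbol), distribution axioms $\Box(A\to B)\to\Box A\to\Box B$, $\Box(A\to B)\to\Diamond A\to\Diamond B$, $\blacksquare(A\to B)\to\blacksquare A\to\blacksquare B$, $\blacksquare(A\to B)\to\Diamond^{\bullet}A\to\Diamond^{\bullet}B$, necessitation for $\Box$ and $\blacksquare$, and tense axioms $\Diamond^{\bullet}\Box A\to A$, $A\to\Box\Diamond^{\bullet}A$, $\Diamond\blacksquare A\to A$, $A\to\blacksquare\Diamond A$. A birelational model: worlds $W$ with partial order $\le$, class $\mathcal{W}\subseteq\mathcal{P}(W)$ of upward-closed sets, interpretations $P_{\mathfrak{B}}\in\mathcal{W}$, accessibility relation $R$ that is a bisimulation for $\le$ (if $vRw\le w'$ then some $v'\ge v$ has $v'Rw'$; if $v'\ge vRw$ then some $w'\ge w$ has $v'Rw'$); satisfaction: $v\models P$ iff $v\in P_{\mathfrak{B}}$; $v\models A\to B$ iff every $v'\ge v$ satisfying $A$ satisfies $B$; $v\models\Box A$ iff $w'\models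 A$ whenever $v\le v'Rw'$; $v\models\blacksquare A$ iff $u'\models A$ whenever $v\le v'$ and $u'Rv'$; $v\models\forall XA$ iff $v'\models A[V/X]$ for all $v'\ge v$, $V\in\mathcal{W}$ (each $V\in\mathcal{W}$ treated as a symbol interpreted by itself); and comprehensiveness: $\{w : w\models C\}\in\mathcal{W}$ for every closed formula $C$ of the expanded language. $\mathfrak{B}\models A$ means every world satisfies $A$. -}

module Defs where

open import Data.Nat using (ℕ; zero; suc)
open import Data.Fin using (Fin; zero; suc)
open import Data.Sum using (_⊎_; inj₁; inj₂; [_,_])
open import Data.Product using (Σ; ∃; _×_; _,_)
open import Data.Unit using (⊤)
open import Function using (id; _⇔_)
open import Relation.Binary.PropositionalEquality using (_≡_; _≢_)
open import Relation.Binary.Structures using (IsPartialOrder)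

-- Syntax.  Formulas over a type S of propositional symbols, with n
-- bound second-order propositional variables X (de Bruijn indices).

infixr 5 _⇒_

data Form (S : Set) (n : ℕ) : Set where
  atom : S → Form S n
  var  : Fin n → Form S n
  _⇒_  : Form S n → Form S n → Form S n
  □    : Form S n → Form S n
  ■    : Form S n → Form S n
  all  : Form S (suc n) → Form S n

rename : ∀ {S m n} → (Fin m → Fin n) → Form S m → Form S n
rename ρ (atom s) = atom s
rename ρ (var x)  = var (ρ x)
rename ρ (A ⇒ B)  = rename ρ A ⇒ rename ρ B
rename ρ (□ A)    = □ (rename ρ A)
rename ρ (■ A)    = ■ (rename ρ A)
rename ρ (all A)  = all (rename (λ { zero → zero ; (suc x) → suc (ρ x) }) A)

wk : ∀ {S n} → Form S n → Form S (suc n)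
wk = rename suc

lift : ∀ {S m n} → (Fin m → Form S n) → Fin (suc m) → Form S (suc n)
lift σ zero    = var zero
lift σ (suc x) = wk (σ x)

subst : ∀ {S m n} → (Fin m → Form S n) → Form S m → Form S n
subst σ (atom s) = atom s
subst σ (var x)  = σ x
subst σ (A ⇒ B)  = subst σ A ⇒ subst σ B
subst σ (□ A)    = □ (subst σ A)
subst σ (■ A)    = ■ (subst σ A)
subst σ (all A)  = all (subst (lift σ) A)

_[_/X] : ∀ {S n} → Form S (suc n) → Form S n → Form S n
A [ C /X] = subst (λ { zero → C ; (suc x) → var x }) A

⊥' : ∀ {S n} → Form S n
⊥' = all (var zero)

¬' : ∀ {S n} → Form S n → Form S n
¬' A = A ⇒ ⊥'

◇ : ∀ {S n} → Form S n → Form S n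
◇ A = all (□ (wk A ⇒ ■ (var zero)) ⇒ var zero)

◆ : ∀ {S n} → Form S n → Form S n
◆ A = all (■ (wk A ⇒ □ (var zero)) ⇒ var zero)

_∉_ : ∀ {n} → ℕ → Form ℕ n → Set
P ∉ atom s  = P ≢ s
P ∉ var x   = ⊤
P ∉ (A ⇒ B) = (P ∉ A) × (P ∉ B)
P ∉ □ A     = P ∉ A
P ∉ ■ A     = P ∉ A
P ∉ all A   = P ∉ A

Fm : Set
Fm = Form ℕ 0

data ⊢_ : Fm → Set where
  ax-K    : ∀ A B → ⊢ (A ⇒ B ⇒ A)
  ax-S    : ∀ A B C → ⊢ ((A ⇒ B ⇒ C) ⇒ (A ⇒ B) ⇒ A ⇒ C)
  ax-comp : ∀ (A : Form ℕ 1) (C : Fm) → ⊢ (all A ⇒ (A [ C /X]))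
  ax-∀⇒   : ∀ (A : Form ℕ 1) (B : Fm) → ⊢ (all (wk B ⇒ A) ⇒ B ⇒ all A)
  mp      : ∀ {A B} → ⊢ (A ⇒ B) → ⊢ A → ⊢ B
  gen     : ∀ (A : Form ℕ 1) (P : ℕ) → P ∉ A → ⊢ (A [ atom P /X]) → ⊢ all A
  dist-□  : ∀ A B → ⊢ (□ (A ⇒ B) ⇒ □ A ⇒ □ B)
  dist-◇  : ∀ A B → ⊢ (□ (A ⇒ B) ⇒ ◇ A ⇒ ◇ B)
  dist-■  : ∀ A B → ⊢ (■ (A ⇒ B) ⇒ ■ A ⇒ ■ B)
  dist-◆  : ∀ A B → ⊢ (■ (A ⇒ B) ⇒ ◆ A ⇒ ◆ B)
  nec-□   : ∀ {A} → ⊢ A → ⊢ □ A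
  nec-■   : ∀ {A} → ⊢ A → ⊢ ■ A
  tense₁  : ∀ A → ⊢ (◆ (□ A) ⇒ A)
  tense₂  : ∀ A → ⊢ (A ⇒ □ (◆ A))
  tense₃  : ∀ A → ⊢ (◇ (■ A) ⇒ A)
  tense₄  : ∀ A → ⊢ (A ⇒ ■ (◇ A))

-- The class 𝒲 ⊆ 𝒫(W) is given as a family of subsets indexed by a type I
-- (ext i is the subset named by i); a subset U is "in 𝒲" iff it is
-- extensionally equal to some ext i.

record Structure : Set₁ where
  field
    W      : Set
    _≤_    : W → W → Set
    ≤-po   : IsPartialOrder _≡_ _≤_
    I      : Set
    ext    : I → W → Set
    upward : ∀ i {v v'} → v ≤ v' → ext i v → ext i v'
    val    : ℕ → I
    R      : W → W → Set
    bisim₁ : ∀ {v w w'} → R v w → w ≤ w' → ∃ λ v' → (v ≤ v') × R v' w'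
    bisim₂ : ∀ {v v' w} → v ≤ v' → R v w → ∃ λ w' → (w ≤ w') × R v' w'

  -- satisfaction; symbols interpreted by σ, bound variables by env ρ
  -- (elements of 𝒲 substituted for X are interpreted by themselves)
  sat : ∀ {S n} → (S → I) → (Fin n → I) → Form S n → W → Set
  sat σ ρ (atom s) v = ext (σ s) v
  sat σ ρ (var x)  v = ext (ρ x) v
  sat σ ρ (A ⇒ B)  v = ∀ v' → v ≤ v' → sat σ ρ A v' → sat σ ρ B v'
  sat σ ρ (□ A)    v = ∀ v' w' → v ≤ v' → R v' w' → sat σ ρ A w'
  sat σ ρ (■ A)    v = ∀ v' u' → v ≤ v' → R u' v' → sat σ ρ A u'
  sat σ ρ (all A)  v = ∀ v' → v ≤ v' → (V : I) →
                         sat σ (λ { zero → V ; (suc x) → ρ x }) A v'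

  -- closed formulas of the expanded language: symbols ℕ ⊎ 𝒲
  _⊨ₑ_ : W → Form (ℕ ⊎ I) 0 → Set
  w ⊨ₑ C = sat [ val , id ] (λ ()) C w

  _⊨_ : W → Fm → Set
  w ⊨ A = sat val (λ ()) A w

record BirelationalModel : Set₁ where
  field
    structure : Structure
  open Structure structure public
  field
    comprehensive : ∀ (C : Form (ℕ ⊎ I) 0) → ∃ λ i → ∀ w → ext i w ⇔ (w ⊨ₑ C)

_⊨ᴹ_ : BirelationalModel → Fm → Set
𝔅 ⊨ᴹ A = ∀ w → w ⊨ A
  where open BirelationalModel 𝔅

-- Soundness is proved for every interpretation of the propositional symbols at once, so that
-- generalisation is validated by reinterpreting its fresh symbol as an arbitrary member of 𝒲.
-- The second-order quantifier ranges only over 𝒲, so the comprehension axiom, and the tense axioms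
-- ◆□A → A and ◇■A → A (which instantiate the bound variable of ◆ resp. ◇ by A itself), need the
-- extension of a formula to lie in 𝒲: this is what comprehensiveness provides.  The tense axioms
-- A → □◆A and A → ■◇A use the two bisimulation clauses.
module Submission where

open import Defs
open import Data.Nat using (ℕ; suc; _≟_)
open import Data.Fin using (Fin; zero; suc)
open import Data.Sum using (inj₂; [_,_])
open import Data.Product using (∃; _×_; _,_; proj₁; proj₂)
open import Data.Empty using (⊥-elim)
open import Function using (id; _∘_; flip; Equivalence)
open import Level using (0ℓ)
open import Relation.Nullary using (yes; no)
open import Relation.Binary.PropositionalEquality using (_≡_; _≢_; refl)
open import Relation.Binary.Structures using (IsPartialOrder)
open import Relation.Unary using (Pred; _⊆_; _≐_; Universal)
open import Relation.Unary.Properties using (≐-refl; ≐-trans)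

mapAtoms : ∀ {S S' n} → (S → S') → Form S n → Form S' n
mapAtoms f (atom s) = atom (f s)
mapAtoms f (var x)  = var x
mapAtoms f (A ⇒ B)  = mapAtoms f A ⇒ mapAtoms f B
mapAtoms f (□ A)    = □ (mapAtoms f A)
mapAtoms f (■ A)    = ■ (mapAtoms f A)
mapAtoms f (all A)  = all (mapAtoms f A)

update : ∀ {A : Set} → ℕ → A → (ℕ → A) → ℕ → A
update P V σ s with P ≟ s
... | yes _ = V
... | no  _ = σ s

update-same : ∀ {A : Set} P (V : A) σ → update P V σ P ≡ V
update-same P V σ with P ≟ P
... | yes _  = refl
... | no P≢P = ⊥-elim (P≢P refl)

update-other : ∀ {A : Set} {P s} (V : A) σ → P ≢ s → update P V σ s ≡ σ s
update-other {P = P} {s} V σ P≢s with P ≟ s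
... | yes P≡s = ⊥-elim (P≢s P≡s)
... | no  _   = refl

module Semantics (M : Structure) where
  open Structure M
  open IsPartialOrder ≤-po using () renaming (refl to ≤-refl; trans to ≤-trans)

  Upset : Pred W 0ℓ → Set
  Upset P = ∀ {v v'} → v ≤ v' → P v → P v'

  infixr 5 _⟶_
  infix 6 [_]_ ⟨_⟩_

  _⟶_ : Pred W 0ℓ → Pred W 0ℓ → Pred W 0ℓ
  (P ⟶ P') v = ∀ v' → v ≤ v' → P v' → P' v'

  [_]_ : (W → W → Set) → Pred W 0ℓ → Pred W 0ℓ
  ([ Q ] P) v = ∀ v' w' → v ≤ v' → Q v' w' → P w'

  -- F may depend on the worlds w ≤ v, as the environment that sat builds for a quantifier does.
  ⋀ : (W → W → I → Pred W 0ℓ) → Pred W 0ℓ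
  ⋀ F w = ∀ v → w ≤ v → ∀ V → F w v V v

  ⟨_⟩_ : (W → W → Set) → Pred W 0ℓ → Pred W 0ℓ
  ⟨ Q ⟩ P = ⋀ λ _ _ V → [ Q ] (P ⟶ [ flip Q ] ext V) ⟶ ext V

  variable
    P P' P₁ P₁' : Pred W 0ℓ
    F G : W → W → I → Pred W 0ℓ
    Q : W → W → Set

  ⟶-mono : P' ⊆ P → P₁ ⊆ P₁' → (P ⟶ P₁) ⊆ (P' ⟶ P₁')
  ⟶-mono p q f v l a = q (f v l (p a))

  ⟶-cong : P ≐ P' → P₁ ≐ P₁' → (P ⟶ P₁) ≐ (P' ⟶ P₁')
  ⟶-cong (p , p') (q , q') = ⟶-mono p' q , ⟶-mono p q'

  []-mono : P ⊆ P' → [ Q ] P ⊆ [ Q ] P'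
  []-mono p f v w l q = p (f v w l q)

  []-cong : P ≐ P' → [ Q ] P ≐ [ Q ] P'
  []-cong (p , p') = []-mono p , []-mono p'

  ⋀-cong : (∀ w v V → F w v V ≐ G w v V) → ⋀ F ≐ ⋀ G
  ⋀-cong h = (λ {w} f v l V → proj₁ (h w v V) (f v l V))
            , (λ {w} g v l V → proj₂ (h w v V) (g v l V))

  valid-⟶ : P ⊆ P' → Universal (P ⟶ P')
  valid-⟶ p _ _ _ = p

  []-distrib : Universal ([ Q ] (P ⟶ P') ⟶ [ Q ] P ⟶ [ Q ] P')
  []-distrib _ _ _ f _ l g v w l' q = f v w (≤-trans l l') q w ≤-refl (g v w l' q)

  ⟨⟩-distrib : Universal ([ Q ] (P ⟶ P') ⟶ ⟨ Q ⟩ P ⟶ ⟨ Q ⟩ P')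
  ⟨⟩-distrib _ _ _ f _ l₁ g _ l₂ V v l₃ h =
    g v (≤-trans l₂ l₃) V v ≤-refl λ v' w' l' q w'' l'' p →
      h v' w' l' q w'' l'' (f v' w' (≤-trans l₁ (≤-trans l₂ (≤-trans l₃ l'))) q w'' l'' p)

  ⟨⟩-[]-counit : ∀ {V} → P ≐ ext V → ⟨ Q ⟩ ([ flip Q ] P) ⊆ P
  ⟨⟩-[]-counit {V = V} (P⊆V , V⊆P) g =
    V⊆P (g _ ≤-refl V _ ≤-refl λ _ _ _ _ _ _ → []-mono P⊆V)

  []-⟨⟩-unit : (∀ {v w w'} → Q v w → w ≤ w' → ∃ λ v' → v ≤ v' × Q v' w') →
               Upset P → P ⊆ [ Q ] ⟨ flip Q ⟩ P
  []-⟨⟩-unit zig P-upward p _ _ l q _ l' V w l'' h =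
    let v , v≥ , q' = zig q (≤-trans l' l'')
    in  h w v ≤-refl q' v ≤-refl (P-upward (≤-trans l v≥) p) v w ≤-refl q'

  variable
    S : Set
    m n : ℕ
    σ : S → I
    ρ ρ' : Fin n → I

  sat-upward : ∀ (A : Form S n) → Upset (sat σ ρ A)
  sat-upward (atom s) = upward _
  sat-upward (var x)  = upward _
  sat-upward (A ⇒ B)  = λ l f v l' → f v (≤-trans l l')
  sat-upward (□ A)    = λ l f v w l' → f v w (≤-trans l l')
  sat-upward (■ A)    = λ l f v w l' → f v w (≤-trans l l')
  sat-upward (all A)  = λ l f v l' → f v (≤-trans l l')

  sat-rename : (r : Fin m → Fin n) → (∀ x → ext (ρ (r x)) ≐ ext (ρ' x)) →
               ∀ (A : Form S m) → sat σ ρ (rename r A) ≐ sat σ ρ' A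
  sat-rename r h (atom s) = ≐-refl
  sat-rename r h (var x)  = h x
  sat-rename r h (A ⇒ B)  = ⟶-cong (sat-rename r h A) (sat-rename r h B)
  sat-rename r h (□ A)    = []-cong (sat-rename r h A)
  sat-rename r h (■ A)    = []-cong (sat-rename r h A)
  sat-rename r h (all A)  = ⋀-cong λ _ _ _ → sat-rename _ (λ { zero → ≐-refl ; (suc x) → h x }) A

  sat-wk : {ρ₁ : Fin (suc n) → I} → (∀ x → ext (ρ₁ (suc x)) ≐ ext (ρ x)) →
           ∀ (A : Form S n) → sat σ ρ₁ (wk A) ≐ sat σ ρ A
  sat-wk h = sat-rename suc h

  sat-subst : (τ : Fin m → Form S n) → (∀ x → sat σ ρ (τ x) ≐ ext (ρ' x)) →
              ∀ A → sat σ ρ (subst τ A) ≐ sat σ ρ' A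
  sat-subst τ h (atom s) = ≐-refl
  sat-subst τ h (var x)  = h x
  sat-subst τ h (A ⇒ B)  = ⟶-cong (sat-subst τ h A) (sat-subst τ h B)
  sat-subst τ h (□ A)    = []-cong (sat-subst τ h A)
  sat-subst τ h (■ A)    = []-cong (sat-subst τ h A)
  sat-subst τ h (all A)  = ⋀-cong λ _ _ _ → sat-subst _
    (λ { zero → ≐-refl ; (suc x) → ≐-trans (sat-wk (λ _ → ≐-refl) (τ x)) (h x) }) A

  sat-[/X] : ∀ {ρ' : Fin (suc n) → I} (A : Form S (suc n)) {C} →
             sat σ ρ C ≐ ext (ρ' zero) → (∀ x → ext (ρ x) ≐ ext (ρ' (suc x))) →
             sat σ ρ (A [ C /X]) ≐ sat σ ρ' A
  sat-[/X] A hC h = sat-subst _ (λ { zero → hC ; (suc x) → h x }) A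

  sat-mapAtoms : ∀ {S'} {σ' : S' → I} (f : S → S') → (∀ s → ext (σ' (f s)) ≐ ext (σ s)) →
                 (∀ x → ext (ρ' x) ≐ ext (ρ x)) →
                 ∀ A → sat σ' ρ' (mapAtoms f A) ≐ sat σ ρ A
  sat-mapAtoms f hs h (atom s) = hs s
  sat-mapAtoms f hs h (var x)  = h x
  sat-mapAtoms f hs h (A ⇒ B)  = ⟶-cong (sat-mapAtoms f hs h A) (sat-mapAtoms f hs h B)
  sat-mapAtoms f hs h (□ A)    = []-cong (sat-mapAtoms f hs h A)
  sat-mapAtoms f hs h (■ A)    = []-cong (sat-mapAtoms f hs h A)
  sat-mapAtoms f hs h (all A)  =
    ⋀-cong λ _ _ _ → sat-mapAtoms f hs (λ { zero → ≐-refl ; (suc x) → h x }) A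

  sat-fresh : ∀ {P} {σ σ' : ℕ → I} → (∀ s → P ≢ s → ext (σ' s) ≐ ext (σ s)) →
              (∀ x → ext (ρ' x) ≐ ext (ρ x)) →
              ∀ A → P ∉ A → sat σ' ρ' A ≐ sat σ ρ A
  sat-fresh hs h (atom s) P≢s         = hs s P≢s
  sat-fresh hs h (var x)  _           = h x
  sat-fresh hs h (A ⇒ B)  (P∉A , P∉B) = ⟶-cong (sat-fresh hs h A P∉A) (sat-fresh hs h B P∉B)
  sat-fresh hs h (□ A)    P∉A         = []-cong (sat-fresh hs h A P∉A)
  sat-fresh hs h (■ A)    P∉A         = []-cong (sat-fresh hs h A P∉A)
  sat-fresh hs h (all A)  P∉A         =
    ⋀-cong λ _ _ _ → sat-fresh hs (λ { zero → ≐-refl ; (suc x) → h x }) A P∉A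

  sat-◇ : ∀ (A : Form S n) → sat σ ρ (◇ A) ≐ ⟨ R ⟩ sat σ ρ A
  sat-◇ A = ⋀-cong λ _ _ _ → ⟶-cong ([]-cong (⟶-cong (sat-wk (λ _ → ≐-refl) A) ≐-refl)) ≐-refl

  sat-◆ : ∀ (A : Form S n) → sat σ ρ (◆ A) ≐ ⟨ flip R ⟩ sat σ ρ A
  sat-◆ A = ⋀-cong λ _ _ _ → ⟶-cong ([]-cong (⟶-cong (sat-wk (λ _ → ≐-refl) A) ≐-refl)) ≐-refl

module Soundness (𝔅 : BirelationalModel) where
  open BirelationalModel 𝔅
  open Semantics structure
  open IsPartialOrder ≤-po using () renaming (refl to ≤-refl; trans to ≤-trans)

  ≡⇒ext-≐ : ∀ {i j} → i ≡ j → ext i ≐ ext j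
  ≡⇒ext-≐ refl = ≐-refl

  extension : ∀ (σ : ℕ → I) (ρ : Fin 0 → I) C → ∃ λ i → sat σ ρ C ≐ ext i
  extension σ ρ C =
    let i , i⇔C = comprehensive (mapAtoms (inj₂ ∘ σ) C)
    in  i , (λ {w} → Equivalence.from (i⇔C w) ∘ proj₂ mapped)
          , (λ {w} → proj₁ mapped ∘ Equivalence.to (i⇔C w))
    where
      mapped : ∀ {ρ' : Fin 0 → I} → sat [ val , id ] ρ' (mapAtoms (inj₂ ∘ σ) C) ≐ sat σ ρ C
      mapped = sat-mapAtoms (inj₂ ∘ σ) (λ _ → ≐-refl) (λ ()) C

  sound : ∀ {A} → ⊢ A → ∀ σ (ρ : Fin 0 → I) → Universal (sat σ ρ A)
  sound (ax-K A B)   _ _ _ _ _ a _ l _ = sat-upward A l a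
  sound (ax-S A B C) _ _ _ _ _ f _ l g v l' a = f v (≤-trans l l') a v ≤-refl (g v l' a)
  sound (ax-comp A C) σ ρ _ v _ ∀A =
    let i , C≐i = extension σ ρ C
    in  proj₂ (sat-[/X] A C≐i λ ()) (∀A v ≤-refl i)
  sound (ax-∀⇒ A B) _ _ _ _ _ f _ l b v l' V =
    f v (≤-trans l l') V v ≤-refl (proj₂ (sat-wk (λ ()) B) (sat-upward B l' b))
  sound (mp d e) σ ρ w = sound d σ ρ w w ≤-refl (sound e σ ρ w)
  sound (gen A P P∉A d) σ ρ _ v _ V =
    let σ' = update P V σ
    in  proj₁ (sat-fresh (λ s P≢s → ≡⇒ext-≐ (update-other V σ P≢s)) (λ _ → ≐-refl) A P∉A)
          (proj₁ (sat-[/X] A (≡⇒ext-≐ (update-same P V σ)) λ ()) (sound d σ' ρ v))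
  sound (dist-□ A B) _ _ = []-distrib
  sound (dist-■ A B) _ _ = []-distrib
  sound (dist-◇ A B) _ _ w =
    proj₂ (⟶-cong ≐-refl (⟶-cong (sat-◇ A) (sat-◇ B))) (⟨⟩-distrib w)
  sound (dist-◆ A B) _ _ w =
    proj₂ (⟶-cong ≐-refl (⟶-cong (sat-◆ A) (sat-◆ B))) (⟨⟩-distrib w)
  sound (nec-□ d) σ ρ _ _ w _ _ = sound d σ ρ w
  sound (nec-■ d) σ ρ _ _ w _ _ = sound d σ ρ w
  sound (tense₁ A) σ ρ =
    valid-⟶ (⟨⟩-[]-counit (proj₂ (extension σ ρ A)) ∘ proj₁ (sat-◆ (□ A)))
  sound (tense₂ A) _ _ =
    valid-⟶ ([]-mono (proj₂ (sat-◆ A)) ∘ []-⟨⟩-unit bisim₁ (sat-upward A))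
  sound (tense₃ A) σ ρ =
    valid-⟶ (⟨⟩-[]-counit (proj₂ (extension σ ρ A)) ∘ proj₁ (sat-◇ (■ A)))
  sound (tense₄ A) _ _ =
    valid-⟶ ([]-mono (proj₂ (sat-◇ A)) ∘ []-⟨⟩-unit (λ r l → bisim₂ l r) (sat-upward A))

theorem3p4 : ∀ (A : Fm) → ⊢ A → (𝔅 : BirelationalModel) → 𝔅 ⊨ᴹ A
theorem3p4 A ⊢A 𝔅 w = Soundness.sound 𝔅 ⊢A (BirelationalModel.val 𝔅) _ w
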